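{- (Provably in $\mathrm{EA}$.) For every tree ordinal $t$ and every natural number $x$, $Cr(t[x])\le Cr(t)$.
   Context: Tree ordinals: the set of formal terms given by $0$ and, for terms $t_1,\dots,t_n$ ($n\ge1$), the formal unnormalized sum $\omega^{t_1}+\dots+\omega^{t_n}$. Sum is concatenation of summands ($0$ neutral); $1:=\omega^0$; $t+1$ appends $\omega^0$; $t\cdot0=0$, $t\cdot(x+1)=t\cdot x+t$. A nonzero term is a successor if its last summand is $\omega^0$, otherwise a limit. Fundamental sequences: $0[x]=0$, $(t+1)[x]=t$, $(t+\omega^{s+1})[x]=t+\omega^s\cdot x$, $(t+\omega^\lambda)[x]=t+\omega^{\lambda[x]}$ for limit $\lambda$ ($t$ may be $0$). Value $o(0)=0$, $o(\omega^{t_1}+\dots+\omega^{t_n})=\omega^{o(t_1)}+\dots+\omega^{o(t_n)}$ (ordinal arithmetic); $t<s$ means $o(t)<o(s)$. Norm on terms: $N0=0$, $N(\omega^{t_1}+\dots+\omega^{t_n})=\sum_i(1+Nt_i)$. Correction: $Cr(0)=0$, $Cr(\omega^{t_1}+\dots+\omega^{t_n})=\sum\{N(\omega^{t_i}):t_i<t_j\text{ for some }j>i\}+\max\{Cr(t_i):i\le n\}$. -}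

module Defs where

open import Data.Nat using (ℕ; zero; suc; _⊔_) renaming (_+_ to _+ℕ_)
open import Data.Bool using (Bool; true; false; if_then_else_)
open import Data.List using (List; []; _∷_; _++_)
open import Data.Bool.ListAction using (any)

-- Tree ordinals in snoc form:  𝟎  is the empty sum,  t ⊕ω^ s  is  t + ω^s.
-- So  ω^{t1}+...+ω^{tn} = ((𝟎 ⊕ω^ t1) ⊕ω^ t2) ... ⊕ω^ tn.
data Tree : Set where
  𝟎     : Tree
  _⊕ω^_ : Tree → Tree → Tree

infixl 6 _⊕ω^_ _+ᵗ_
infixl 7 _·ᵗ_

ω^ : Tree → Tree
ω^ s = 𝟎 ⊕ω^ s

𝟏 : Tree
𝟏 = ω^ 𝟎

_+ᵗ_ : Tree → Tree → Tree
t +ᵗ 𝟎 = t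
t +ᵗ (s ⊕ω^ u) = (t +ᵗ s) ⊕ω^ u

_·ᵗ_ : Tree → ℕ → Tree
t ·ᵗ zero = 𝟎
t ·ᵗ suc x = t ·ᵗ x +ᵗ t

_[_] : Tree → ℕ → Tree
𝟎 [ x ] = 𝟎
(t ⊕ω^ 𝟎) [ x ] = t
(t ⊕ω^ (s ⊕ω^ 𝟎)) [ x ] = t +ᵗ ω^ s ·ᵗ x
(t ⊕ω^ (s ⊕ω^ (v ⊕ω^ w))) [ x ] = t ⊕ω^ ((s ⊕ω^ (v ⊕ω^ w)) [ x ])

-- Ordinal values o(t) < ε₀, represented by Cantor normal forms.
-- CNF: [] is 0,  a ∷ r is ω^a + r  (exponents non-increasing when built by nf).
data CNF : Set where
  []ᶜ  : CNF
  _∷ᶜ_ : CNF → CNF → CNF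

data Cmp : Set where
  lt eq gt : Cmp

cmp : CNF → CNF → Cmp
cmp []ᶜ []ᶜ = eq
cmp []ᶜ (_ ∷ᶜ _) = lt
cmp (_ ∷ᶜ _) []ᶜ = gt
cmp (a ∷ᶜ r) (b ∷ᶜ s) with cmp a b
... | lt = lt
... | gt = gt
... | eq = cmp r s

addω : CNF → CNF → CNF
addω []ᶜ b = b ∷ᶜ []ᶜ
addω (a ∷ᶜ r) b with cmp a b
... | lt = b ∷ᶜ []ᶜ
... | eq = a ∷ᶜ addω r b
... | gt = a ∷ᶜ addω r b

o : Tree → CNF
o 𝟎 = []ᶜ
o (t ⊕ω^ s) = addω (o t) (o s)

_<ᵒ_ : Tree → Tree → Set
t <ᵒ s = cmp (o t) (o s) ≡ lt
  where open import Relation.Binary.PropositionalEquality using (_≡_)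

_<ᵒ?_ : Tree → Tree → Bool
t <ᵒ? s with cmp (o t) (o s)
... | lt = true
... | eq = false
... | gt = false

N : Tree → ℕ
N 𝟎 = 0
N (t ⊕ω^ s) = N t +ℕ suc (N s)

summands : Tree → List Tree
summands 𝟎 = []
summands (t ⊕ω^ s) = summands t ++ (s ∷ [])

corrSum : List Tree → ℕ
corrSum [] = 0
corrSum (a ∷ as) =
  (if any (λ b → a <ᵒ? b) as then N (ω^ a) else 0) +ℕ corrSum as

Cr    : Tree → ℕ
maxCr : Tree → ℕ
Cr t = corrSum (summands t) +ℕ maxCr t
maxCr 𝟎 = 0
maxCr (t ⊕ω^ s) = maxCr t ⊔ Cr s

-- Cr(t) adds up the norms of the summands followed by a strictly larger summand, plus
-- the largest correction of an exponent.  Passing from t = T + ω^λ to t[x] = T + u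
-- replaces the last summand by summands whose exponents are all ≤ λ in value (x copies
-- of s < s+1 when λ = s+1, and λ[x] when λ is a limit, as o(λ[x]) ≤ o(λ)).  Hence a
-- summand of T followed by a larger one in t[x] already was so in t, the new summands
-- are not followed by larger ones, and the exponent corrections do not grow, by
-- induction on λ.  The inequality o(t[x]) ≤ o(t) rests on the fact that Q < P + ω^σ′
-- and σ < σ′ imply Q + ω^σ < P + ω^σ′.
module Submission where

open import Defs
open import Data.Nat using (ℕ; _≤_; zero; suc; _⊔_; z≤n)
open import Data.Nat.Properties
  using (≤-refl; ≤-trans; ≤-reflexive; +-mono-≤; ⊔-lub; ⊔-monoʳ-≤; ⊔-identityʳ; ⊔-assoc)
open import Data.Bool using (Bool; true; false; if_then_else_)
open import Data.Bool.Properties using (∨-identityʳ)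
open import Data.Bool.ListAction using (any)
open import Data.List using (List; []; _∷_; _++_; replicate)
open import Data.List.Properties using (++-identityʳ; ++-assoc)
open import Data.List.Relation.Unary.All using (All; []; _∷_)
open import Data.List.Relation.Unary.All.Properties using (replicate⁺)
open import Data.Sum using (_⊎_; inj₁; inj₂)
open import Relation.Binary.PropositionalEquality hiding ([_])

infix 4 _<ᶜ_ _≤ᶜ_ _≼_

data _<ᶜ_ : CNF → CNF → Set where
  []<∷ : ∀ {b s} → []ᶜ <ᶜ b ∷ᶜ s
  ∷<∷ʰ : ∀ {a b r s} → a <ᶜ b → a ∷ᶜ r <ᶜ b ∷ᶜ s
  ∷<∷ᵗ : ∀ {a r s} → r <ᶜ s → a ∷ᶜ r <ᶜ a ∷ᶜ s

_≤ᶜ_ : CNF → CNF → Set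
a ≤ᶜ b = a <ᶜ b ⊎ a ≡ b

cmp-refl : ∀ a → cmp a a ≡ eq
cmp-refl []ᶜ = refl
cmp-refl (a ∷ᶜ r) rewrite cmp-refl a = cmp-refl r

cmp≡lt⇒<ᶜ : ∀ a b → cmp a b ≡ lt → a <ᶜ b
cmp≡eq⇒≡ : ∀ a b → cmp a b ≡ eq → a ≡ b
cmp≡gt⇒>ᶜ : ∀ a b → cmp a b ≡ gt → b <ᶜ a

cmp≡lt⇒<ᶜ []ᶜ (_ ∷ᶜ _) _ = []<∷
cmp≡lt⇒<ᶜ (a ∷ᶜ r) (b ∷ᶜ s) h with cmp a b in a?b
... | lt = ∷<∷ʰ (cmp≡lt⇒<ᶜ a b a?b)
... | eq with refl ← cmp≡eq⇒≡ a b a?b = ∷<∷ᵗ (cmp≡lt⇒<ᶜ r s h)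

cmp≡eq⇒≡ []ᶜ []ᶜ _ = refl
cmp≡eq⇒≡ (a ∷ᶜ r) (b ∷ᶜ s) h with cmp a b in a?b
... | eq = cong₂ _∷ᶜ_ (cmp≡eq⇒≡ a b a?b) (cmp≡eq⇒≡ r s h)

cmp≡gt⇒>ᶜ (_ ∷ᶜ _) []ᶜ _ = []<∷
cmp≡gt⇒>ᶜ (a ∷ᶜ r) (b ∷ᶜ s) h with cmp a b in a?b
... | gt = ∷<∷ʰ (cmp≡gt⇒>ᶜ a b a?b)
... | eq with refl ← cmp≡eq⇒≡ a b a?b = ∷<∷ᵗ (cmp≡gt⇒>ᶜ r s h)

<ᶜ⇒cmp≡lt : ∀ {a b} → a <ᶜ b → cmp a b ≡ lt
<ᶜ⇒cmp≡gt : ∀ {a b} → a <ᶜ b → cmp b a ≡ gt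

<ᶜ⇒cmp≡lt []<∷ = refl
<ᶜ⇒cmp≡lt (∷<∷ʰ a<b) rewrite <ᶜ⇒cmp≡lt a<b = refl
<ᶜ⇒cmp≡lt {a ∷ᶜ _} (∷<∷ᵗ r<s) rewrite cmp-refl a = <ᶜ⇒cmp≡lt r<s

<ᶜ⇒cmp≡gt []<∷ = refl
<ᶜ⇒cmp≡gt (∷<∷ʰ a<b) rewrite <ᶜ⇒cmp≡gt a<b = refl
<ᶜ⇒cmp≡gt {a ∷ᶜ _} (∷<∷ᵗ r<s) rewrite cmp-refl a = <ᶜ⇒cmp≡gt r<s

<ᶜ-trans : ∀ {a b c} → a <ᶜ b → b <ᶜ c → a <ᶜ c
<ᶜ-trans []<∷ (∷<∷ʰ _) = []<∷
<ᶜ-trans []<∷ (∷<∷ᵗ _) = []<∷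
<ᶜ-trans (∷<∷ʰ a<b) (∷<∷ʰ b<c) = ∷<∷ʰ (<ᶜ-trans a<b b<c)
<ᶜ-trans (∷<∷ʰ a<b) (∷<∷ᵗ _) = ∷<∷ʰ a<b
<ᶜ-trans (∷<∷ᵗ _) (∷<∷ʰ b<c) = ∷<∷ʰ b<c
<ᶜ-trans (∷<∷ᵗ r<s) (∷<∷ᵗ s<u) = ∷<∷ᵗ (<ᶜ-trans r<s s<u)

<-≤ᶜ-trans : ∀ {a b c} → a <ᶜ b → b ≤ᶜ c → a <ᶜ c
<-≤ᶜ-trans a<b (inj₁ b<c) = <ᶜ-trans a<b b<c
<-≤ᶜ-trans a<b (inj₂ refl) = a<b

<ᶜ-addω : ∀ c b → c <ᶜ addω c b
<ᶜ-addω []ᶜ b = []<∷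
<ᶜ-addω (a ∷ᶜ r) b with cmp a b in a?b
... | lt = ∷<∷ʰ (cmp≡lt⇒<ᶜ a b a?b)
... | eq = ∷<∷ᵗ (<ᶜ-addω r b)
... | gt = ∷<∷ᵗ (<ᶜ-addω r b)

-- If σ < a, adding ω^σ below a ∷ Rest either stays below a or only changes a tail below Rest.
addω-<ᶜ-∷ : ∀ {σ a Rest} → σ <ᶜ a → (∀ {r} → r <ᶜ Rest → addω r σ <ᶜ Rest) →
            ∀ {Q} → Q <ᶜ a ∷ᶜ Rest → addω Q σ <ᶜ a ∷ᶜ Rest
addω-<ᶜ-∷ σ<a _ []<∷ = ∷<∷ʰ σ<a
addω-<ᶜ-∷ {σ} σ<a _ (∷<∷ʰ {q} q<a) with cmp q σ
... | lt = ∷<∷ʰ σ<a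
... | eq = ∷<∷ʰ q<a
... | gt = ∷<∷ʰ q<a
addω-<ᶜ-∷ σ<a addω-<ᶜ-Rest (∷<∷ᵗ r<Rest) rewrite <ᶜ⇒cmp≡gt σ<a = ∷<∷ᵗ (addω-<ᶜ-Rest r<Rest)

addω-<ᶜ-ω^ : ∀ {σ σ′ Q} → σ <ᶜ σ′ → Q <ᶜ σ′ ∷ᶜ []ᶜ → addω Q σ <ᶜ σ′ ∷ᶜ []ᶜ
addω-<ᶜ-ω^ σ<σ′ = addω-<ᶜ-∷ σ<σ′ (λ ())

addω-<ᶜ-addω : ∀ P {σ σ′ Q} → σ <ᶜ σ′ → Q <ᶜ addω P σ′ → addω Q σ <ᶜ addω P σ′
addω-<ᶜ-addω []ᶜ σ<σ′ = addω-<ᶜ-ω^ σ<σ′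
addω-<ᶜ-addω (a ∷ᶜ R) {σ′ = σ′} σ<σ′ with cmp a σ′ in a?σ′
... | lt = addω-<ᶜ-ω^ σ<σ′
... | eq = addω-<ᶜ-∷ (<-≤ᶜ-trans σ<σ′ (inj₂ (sym (cmp≡eq⇒≡ a σ′ a?σ′))))
                     (addω-<ᶜ-addω R σ<σ′)
... | gt = addω-<ᶜ-∷ (<ᶜ-trans σ<σ′ (cmp≡gt⇒>ᶜ a σ′ a?σ′)) (addω-<ᶜ-addω R σ<σ′)

addω-monoʳ-<ᶜ : ∀ P {β γ} → β <ᶜ γ → addω P β <ᶜ addω P γ
addω-monoʳ-<ᶜ []ᶜ β<γ = ∷<∷ʰ β<γ
addω-monoʳ-<ᶜ (a ∷ᶜ r) {β} {γ} β<γ with cmp a γ in a?γ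
... | lt = addω-<ᶜ-ω^ β<γ (∷<∷ʰ (cmp≡lt⇒<ᶜ a γ a?γ))
... | eq rewrite <ᶜ⇒cmp≡gt (<-≤ᶜ-trans β<γ (inj₂ (sym (cmp≡eq⇒≡ a γ a?γ)))) =
  ∷<∷ᵗ (addω-monoʳ-<ᶜ r β<γ)
... | gt rewrite <ᶜ⇒cmp≡gt (<ᶜ-trans β<γ (cmp≡gt⇒>ᶜ a γ a?γ)) = ∷<∷ᵗ (addω-monoʳ-<ᶜ r β<γ)

o-+ᵗ-ω^·-<ᶜ : ∀ T s x → o (T +ᵗ ω^ s ·ᵗ x) <ᶜ o (T ⊕ω^ (s ⊕ω^ 𝟎))
o-+ᵗ-ω^·-<ᶜ T s zero = <ᶜ-addω (o T) _
o-+ᵗ-ω^·-<ᶜ T s (suc x) =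
  addω-<ᶜ-addω (o T) (<ᶜ-addω (o s) []ᶜ) (o-+ᵗ-ω^·-<ᶜ T s x)

o-fs-≤ᶜ : ∀ t x → o (t [ x ]) ≤ᶜ o t
o-fs-≤ᶜ 𝟎 x = inj₂ refl
o-fs-≤ᶜ (T ⊕ω^ 𝟎) x = inj₁ (<ᶜ-addω (o T) []ᶜ)
o-fs-≤ᶜ (T ⊕ω^ (s ⊕ω^ 𝟎)) x = inj₁ (o-+ᵗ-ω^·-<ᶜ T s x)
o-fs-≤ᶜ (T ⊕ω^ λ′@(_ ⊕ω^ (_ ⊕ω^ _))) x with o-fs-≤ᶜ λ′ x
... | inj₁ λ′[x]<λ′ = inj₁ (addω-monoʳ-<ᶜ (o T) λ′[x]<λ′)
... | inj₂ λ′[x]≡λ′ = inj₂ (cong (addω (o T)) λ′[x]≡λ′)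

<ᵒ?⇒<ᶜ : ∀ a b → a <ᵒ? b ≡ true → o a <ᶜ o b
<ᵒ?⇒<ᶜ a b h with cmp (o a) (o b) in a?b
... | lt = cmp≡lt⇒<ᶜ (o a) (o b) a?b

<ᶜ⇒<ᵒ? : ∀ a b → o a <ᶜ o b → a <ᵒ? b ≡ true
<ᶜ⇒<ᵒ? a b a<b rewrite <ᶜ⇒cmp≡lt a<b = refl

<ᵒ?-irrefl : ∀ a → a <ᵒ? a ≡ false
<ᵒ?-irrefl a with cmp (o a) (o a) in a?a
... | lt with () ← trans (sym a?a) (cmp-refl (o a))
... | eq = refl
... | gt = refl

_≼_ : List Tree → List Tree → Set
m ≼ m′ = ∀ a → any (a <ᵒ?_) m ≡ true → any (a <ᵒ?_) m′ ≡ true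

≼-++⁺ˡ : ∀ l {m m′} → m ≼ m′ → l ++ m ≼ l ++ m′
≼-++⁺ˡ [] m≼m′ = m≼m′
≼-++⁺ˡ (b ∷ l) m≼m′ a with a <ᵒ? b
... | true = λ _ → refl
... | false = ≼-++⁺ˡ l m≼m′ a

All-≤ᶜ⇒≼-[_] : ∀ v {m} → All (λ b → o b ≤ᶜ o v) m → m ≼ v ∷ []
All-≤ᶜ⇒≼-[ v ] (_∷_ {b} b≤v bs) a with a <ᵒ? b in a<?b
... | true = λ _ →
  trans (∨-identityʳ (a <ᵒ? v)) (<ᶜ⇒<ᵒ? a v (<-≤ᶜ-trans (<ᵒ?⇒<ᶜ a b a<?b) b≤v))
... | false = All-≤ᶜ⇒≼-[ v ] bs a

if-then-0-mono : ∀ {b b′ : Bool} n → (b ≡ true → b′ ≡ true) →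
                 (if b then n else 0) ≤ (if b′ then n else 0)
if-then-0-mono {false} n _ = z≤n
if-then-0-mono {true} n b⇒b′ rewrite b⇒b′ refl = ≤-refl

corrSum-++-monoʳ : ∀ l {m m′} → m ≼ m′ → corrSum m ≤ corrSum m′ →
                   corrSum (l ++ m) ≤ corrSum (l ++ m′)
corrSum-++-monoʳ [] _ m≤m′ = m≤m′
corrSum-++-monoʳ (a ∷ l) m≼m′ m≤m′ =
  +-mono-≤ (if-then-0-mono (N (ω^ a)) (≼-++⁺ˡ l m≼m′ a)) (corrSum-++-monoʳ l m≼m′ m≤m′)

summands-+ᵗ : ∀ T u → summands (T +ᵗ u) ≡ summands T ++ summands u
summands-+ᵗ T 𝟎 = sym (++-identityʳ (summands T))
summands-+ᵗ T (u ⊕ω^ s) rewrite summands-+ᵗ T u =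
  ++-assoc (summands T) (summands u) (s ∷ [])

maxCr-+ᵗ : ∀ T u → maxCr (T +ᵗ u) ≡ maxCr T ⊔ maxCr u
maxCr-+ᵗ T 𝟎 = sym (⊔-identityʳ (maxCr T))
maxCr-+ᵗ T (u ⊕ω^ s) rewrite maxCr-+ᵗ T u = ⊔-assoc (maxCr T) (maxCr u) (Cr s)

Cr-+ᵗ-monoʳ : ∀ T u u′ → summands u ≼ summands u′ →
              corrSum (summands u) ≤ corrSum (summands u′) → maxCr u ≤ maxCr u′ →
              Cr (T +ᵗ u) ≤ Cr (T +ᵗ u′)
Cr-+ᵗ-monoʳ T u u′ u≼u′ corr≤ maxCr≤
  rewrite summands-+ᵗ T u | summands-+ᵗ T u′ | maxCr-+ᵗ T u | maxCr-+ᵗ T u′ =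
  +-mono-≤ (corrSum-++-monoʳ (summands T) u≼u′ corr≤) (⊔-monoʳ-≤ (maxCr T) maxCr≤)

Cr-≤-Cr-suc : ∀ T → Cr T ≤ Cr (T ⊕ω^ 𝟎)
Cr-≤-Cr-suc T = Cr-+ᵗ-monoʳ T 𝟎 𝟏 (λ _ ()) z≤n z≤n

summands-ω^· : ∀ s x → summands (ω^ s ·ᵗ x) ≡ replicate x s
summands-ω^· s zero = refl
summands-ω^· s (suc x) rewrite summands-ω^· s x = replicate-∷ʳ x
  where
  replicate-∷ʳ : ∀ x → replicate x s ++ s ∷ [] ≡ s ∷ replicate x s
  replicate-∷ʳ zero = refl
  replicate-∷ʳ (suc x) = cong (s ∷_) (replicate-∷ʳ x)

summands-ω^·≼ : ∀ s x → summands (ω^ s ·ᵗ x) ≼ (s ⊕ω^ 𝟎) ∷ []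
summands-ω^·≼ s x rewrite summands-ω^· s x =
  All-≤ᶜ⇒≼-[ s ⊕ω^ 𝟎 ] (replicate⁺ x (inj₁ (<ᶜ-addω (o s) []ᶜ)))

corrSum-ω^· : ∀ s x → corrSum (summands (ω^ s ·ᵗ x)) ≡ 0
corrSum-ω^· s x rewrite summands-ω^· s x = corrSum-replicate x
  where
  any-s<-replicate : ∀ x → any (s <ᵒ?_) (replicate x s) ≡ false
  any-s<-replicate zero = refl
  any-s<-replicate (suc x) rewrite <ᵒ?-irrefl s = any-s<-replicate x

  corrSum-replicate : ∀ x → corrSum (replicate x s) ≡ 0
  corrSum-replicate zero = refl
  corrSum-replicate (suc x) rewrite any-s<-replicate x = corrSum-replicate x

maxCr-ω^· : ∀ s x → maxCr (ω^ s ·ᵗ x) ≤ Cr s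
maxCr-ω^· s zero = z≤n
maxCr-ω^· s (suc x) = ⊔-lub (maxCr-ω^· s x) ≤-refl

lemma19 : (t : Tree) (x : ℕ) → Cr (t [ x ]) ≤ Cr t
lemma19 𝟎 x = ≤-refl
lemma19 (T ⊕ω^ 𝟎) x = Cr-≤-Cr-suc T
lemma19 (T ⊕ω^ (s ⊕ω^ 𝟎)) x =
  Cr-+ᵗ-monoʳ T (ω^ s ·ᵗ x) (ω^ (s ⊕ω^ 𝟎))
    (summands-ω^·≼ s x)
    (≤-reflexive (corrSum-ω^· s x))
    (≤-trans (maxCr-ω^· s x) (Cr-≤-Cr-suc s))
lemma19 (T ⊕ω^ λ′@(_ ⊕ω^ (_ ⊕ω^ _))) x =
  Cr-+ᵗ-monoʳ T (ω^ (λ′ [ x ])) (ω^ λ′)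
    (All-≤ᶜ⇒≼-[ λ′ ] {λ′ [ x ] ∷ []} (o-fs-≤ᶜ λ′ x ∷ []))
    z≤n
    (lemma19 λ′ x)
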